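{- The only asymmetric $3$-quasi-transitive CKI-digraph is $\overrightarrow{C}_3$. Moreover, an asymmetric digraph $D$ that is arc-locally in-semicomplete, or arc-locally out-semicomplete, or $3$-anti-quasi-transitive and $TT_3$-free, is a CKI-digraph if and only if $D$ is a directed cycle of odd length.
   Context: Digraphs are finite, without loops or parallel arcs. $D$ is asymmetric if there are no two vertices $u,v$ with both $uv,vu\in A(D)$. A kernel is a set $S$ of vertices that is independent (no arc between two vertices of $S$) and absorbent (every vertex outside $S$ has an arc into $S$). $D$ is a CKI-digraph if $D$ has no kernel but every proper induced subdigraph has a kernel. Consider paths $uvwx$ on four distinct vertices (not necessarily directed). $D$ is arc-locally in-semicomplete if for every such path with arcs $uv,wv,xw$ the vertices $u,x$ are adjacent; arc-locally out-semicomplete if for every such path with arcs $vu,wv,wx$ the vertices $u,x$ are adjacent; $3$-quasi-transitive if for every directed path $uvwx$ (arcs $uv,vw,wx$) the vertices $u,x$ are adjacent; $3$-anti-quasi-transitive if for every anti-directed path $uvwx$ (a path with no directed subpath of length $2$) the vertices $u,x$ are adjacent. $TT_3$ is the transitive tournament on $3$ vertices, and $TT_3$-free means no induced subdigraph is isomorphic to $TT_3$. $\overrightarrow{C}_3$ is the directed $3$-cycle. -}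

module Defs where

open import Data.Nat using (ℕ; zero; suc; _≤_)
open import Data.Nat.Properties using ()
open import Data.Bool using (Bool; T)
open import Data.Fin using (Fin; toℕ)
open import Data.Fin.Subset using (Subset; _∈_; _∉_; _⊆_; _⊂_; ⊤)
open import Data.Product using (Σ; ∃; ∃-syntax; _×_; _,_)
open import Data.Sum using (_⊎_)
open import Data.Empty using (⊥)
open import Relation.Nullary using (¬_)
open import Relation.Binary.PropositionalEquality using (_≡_; _≢_)
open import Function.Bundles using (_⤖_; Bijection; _⇔_)

-- A finite digraph on vertex set Fin n, given by its (Boolean) arc relation,
-- without loops (parallel arcs are impossible in this representation).
record Digraph : Set where
  field
    n        : ℕ
    arc      : Fin n → Fin n → Bool
    loopless : ∀ v → ¬ T (arc v v)

open Digraph public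

Arc : (D : Digraph) → Fin (n D) → Fin (n D) → Set
Arc D u v = T (arc D u v)

Adjacent : (D : Digraph) → Fin (n D) → Fin (n D) → Set
Adjacent D u v = Arc D u v ⊎ Arc D v u

Asymmetric : Digraph → Set
Asymmetric D = ∀ u v → Arc D u v → ¬ Arc D v u

Distinct4 : {m : ℕ} → Fin m → Fin m → Fin m → Fin m → Set
Distinct4 u v w x = u ≢ v × u ≢ w × u ≢ x × v ≢ w × v ≢ x × w ≢ x

-- Kernels in induced subdigraphs.  The induced subdigraph D[X] is
-- represented by its vertex set X ⊆ V(D).

IsKernelIn : (D : Digraph) → Subset (n D) → Subset (n D) → Set
IsKernelIn D X S =
  S ⊆ X
  × (∀ u v → u ∈ S → v ∈ S → ¬ Arc D u v)
  × (∀ u → u ∈ X → u ∉ S → ∃[ v ] (v ∈ S × Arc D u v))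

HasKernelIn : (D : Digraph) → Subset (n D) → Set
HasKernelIn D X = ∃[ S ] IsKernelIn D X S

HasKernel : Digraph → Set
HasKernel D = HasKernelIn D ⊤

CKI : Digraph → Set
CKI D = ¬ HasKernel D × (∀ X → X ⊂ ⊤ → HasKernelIn D X)

ArcLocallyInSemicomplete : Digraph → Set
ArcLocallyInSemicomplete D = ∀ u v w x → Distinct4 u v w x →
  Arc D u v → Arc D w v → Arc D x w → Adjacent D u x

ArcLocallyOutSemicomplete : Digraph → Set
ArcLocallyOutSemicomplete D = ∀ u v w x → Distinct4 u v w x →
  Arc D v u → Arc D w v → Arc D w x → Adjacent D u x

ThreeQuasiTransitive : Digraph → Set
ThreeQuasiTransitive D = ∀ u v w x → Distinct4 u v w x →
  Arc D u v → Arc D v w → Arc D w x → Adjacent D u x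

AntiDirectedPath : (D : Digraph) → Fin (n D) → Fin (n D) → Fin (n D) → Fin (n D) → Set
AntiDirectedPath D u v w x =
  (Arc D u v × Arc D w v × Arc D w x) ⊎ (Arc D v u × Arc D v w × Arc D x w)

ThreeAntiQuasiTransitive : Digraph → Set
ThreeAntiQuasiTransitive D = ∀ u v w x → Distinct4 u v w x →
  AntiDirectedPath D u v w x → Adjacent D u x

InducesTT3 : (D : Digraph) → Fin (n D) → Fin (n D) → Fin (n D) → Set
InducesTT3 D a b c =
  a ≢ b × a ≢ c × b ≢ c
  × Arc D a b × Arc D b c × Arc D a c
  × ¬ Arc D b a × ¬ Arc D c b × ¬ Arc D c a

TT3Free : Digraph → Set
TT3Free D = ∀ a b c → ¬ InducesTT3 D a b c

CycSucc : {m : ℕ} → Fin m → Fin m → Set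
CycSucc {m} i j = (suc (toℕ i) ≡ toℕ j) ⊎ (suc (toℕ i) ≡ m × toℕ j ≡ 0)

IsDirectedCycle : Digraph → Set
IsDirectedCycle D =
  3 ≤ n D × Σ (Fin (n D) ⤖ Fin (n D)) (λ σ →
    ∀ u v → Arc D u v ⇔ CycSucc (Bijection.to σ u) (Bijection.to σ v))

Odd : ℕ → Set
Odd m = ∃[ k ] m ≡ suc (2 Data.Nat.* k)

module Submission where

open import Defs
open import Data.Nat using (ℕ; zero; suc; pred; _+_; _*_; _∸_; _≤_; _<_; _<ᵇ_; z≤n; s≤s; parity; NonZero; >-nonZero)
open import Data.Nat.Properties
open import Data.Nat.DivMod using (_%_; _/_; m≡m%n+[m/n]*n; m%n<n)
open import Data.Nat.Induction using (<-rec)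
open import Data.Nat.Tactic.RingSolver using (solve-∀)
open import Data.Parity.Base using (Parity; 0ℙ; 1ℙ; _⁻¹) renaming (_+_ to _+ᴾ_)
open import Data.Parity.Properties as ℙ using () renaming (_≟_ to _≟ᴾ_)
open import Data.Bool using (Bool; true; false; not; _∧_; T)
open import Data.Bool.Properties using (not-¬; not-involutive) renaming (_≟_ to _≟ᴮ_)
open import Data.Fin using (Fin; toℕ; fromℕ<)
open import Data.Fin.Properties using (any?; toℕ<n; toℕ-injective; toℕ-fromℕ<; injective⇒≤) renaming (_≟_ to _≟ᶠ_)
open import Data.Fin.Subset using (Subset; _∈_; _∉_; _⊆_; _⊂_; ⊤; ⁅_⁆; _∪_; ∁; ∣_∣)
open import Data.Fin.Subset.Properties using (_∈?_; ∈⊤; ⊆⊤; x∈⁅x⁆; x∈⁅y⁆⇒x≡y; x∈p∪q⁺; x∈p∪q⁻; p⊆p∪q; x∉p⇒x∈∁p; x∈∁p⇒x∉p; p⊂q⇒∣p∣<∣q∣; ∣p∣≤n; ∣⁅x⁆∣≡1)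
open import Data.Vec using (tabulate)
open import Data.Vec.Properties using (lookup∘tabulate; []=⇒lookup; lookup⇒[]=)
open import Data.Product using (Σ; ∃; ∃-syntax; _×_; _,_; proj₁; proj₂)
open import Data.Sum using (_⊎_; inj₁; inj₂; [_,_])
open import Data.Unit using (tt)
open import Data.Empty using (⊥; ⊥-elim)
open import Function.Bundles using (_⤖_; Bijection; _⇔_; mk⤖; mk⇔; Equivalence)
open import Level using (0ℓ)
open import Relation.Binary using (tri<; tri≈; tri>)
open import Relation.Binary.PropositionalEquality using (_≡_; _≢_; refl; sym; trans; cong; subst; subst₂; module ≡-Reasoning)
open import Relation.Nullary using (¬_; Dec; yes; no; does; contradiction; ¬?)
open import Relation.Nullary.Decidable using (T?; dec-true; decidable-stable) renaming (_×-dec_ to _×?_)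
open import Relation.Unary using (Pred; Decidable)
open import Algebra.Properties.CommutativeSemigroup +-commutativeSemigroup using (x∙yz≈y∙xz)

-- Backward direction: an odd directed cycle is CKI.  Going once around it
-- gives a loop that is apart (no repeated vertex), induced (the only arcs
-- between its vertices are its steps) and spanning; kernel membership would
-- have to alternate along an odd loop, and a proper subdigraph misses a
-- vertex, leaving a path whose kernel is chosen greedily from its end.
--
-- Forward direction: a CKI digraph has no sink, is strongly connected (via
-- semikernels) and hence has an odd closed walk.  A shortest odd closed
-- walk, unrolled into a periodic sequence of vertices, has no repeated
-- vertex and no chord across an odd number of steps; a chord across an even
-- number of steps is excluded by a class-specific "handler" (arc-locally in-
-- or out-semicomplete, or 3-anti-quasi-transitive and TT₃-free).  So the
-- shortest odd closed walk is an induced odd loop, which must span D, and D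
-- is an odd directed cycle.  For 3-quasi-transitive D a directed triangle is
-- found directly, and the shortest odd closed walk has length at most 3.

parity-suc : ∀ m → parity (suc m) ≡ parity m ⁻¹
parity-suc m = trans (sym (ℙ.⁻¹-involutive (parity (suc m)))) (cong _⁻¹ (ℙ.suc-homo-⁻¹ m))

parity-+suc : ∀ a b → parity (a + suc b) ≡ parity (a + b) ⁻¹
parity-+suc a b = trans (cong parity (+-suc a b)) (parity-suc (a + b))

odd⇒pos : ∀ {m} → parity m ≡ 1ℙ → 0 < m
odd⇒pos {suc m} _ = s≤s z≤n

Odd⇒parity : ∀ m → Odd m → parity m ≡ 1ℙ
Odd⇒parity m (j , refl) = trans (parity-suc (2 * j)) (cong _⁻¹ (ℙ.*-homo-* 2 j))

parity⇒Odd : ∀ m → parity m ≡ 1ℙ → Odd m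
parity⇒Odd (suc zero) _ = 0 , refl
parity⇒Odd (suc (suc m)) p with parity⇒Odd m p
... | j , refl = suc j , cong suc (sym (*-suc 2 j))

odd-summand : ∀ a b → parity (a + b) ≡ 1ℙ → parity a ≡ 1ℙ ⊎ parity b ≡ 1ℙ
odd-summand a b p with parity a in pa | parity b in pb
... | 1ℙ | _  = inj₁ refl
... | 0ℙ | 1ℙ = inj₂ refl
... | 0ℙ | 0ℙ with () ← trans (sym p) (trans (ℙ.+-homo-+ a b) (trans (cong (_+ᴾ parity b) pa) pb))

both-odd : ∀ {p q : Parity} → p ≢ 0ℙ → q ≢ 0ℙ → p ≡ q
both-odd {0ℙ}      p≢0 _   = contradiction refl p≢0
both-odd {1ℙ} {0ℙ} _   q≢0 = contradiction refl q≢0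
both-odd {1ℙ} {1ℙ} _   _   = refl

-- Even numbers, presented so that `twice (suc m)` unfolds to `2 + twice m`;
-- the chord lengths handled by induction in the theorem are 2 + twice m.
twice : ℕ → ℕ
twice zero    = zero
twice (suc m) = suc (suc (twice m))

parity-twice : ∀ m → parity (twice m) ≡ 0ℙ
parity-twice zero    = refl
parity-twice (suc m) = parity-twice m

even-form : ∀ d → parity d ≡ 0ℙ → 2 ≤ d → ∃[ m ] d ≡ 2 + twice m
even-form (suc (suc zero)) _ _ = 0 , refl
even-form (suc (suc (suc (suc d)))) p _ with even-form (suc (suc d)) p (s≤s (s≤s z≤n))
... | m , e = suc m , cong (λ x → suc (suc x)) e

-- A Boolean sequence that flips at every step takes different values at
-- the two ends of an odd interval (kernel membership along an odd cycle).
flip-odd : ∀ (f : ℕ → Bool) k → (∀ a → a < k → f (suc a) ≡ not (f a))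
         → parity k ≡ 1ℙ → f k ≡ not (f 0)
flip-odd f (suc zero)    flips _   = flips 0 (s≤s z≤n)
flip-odd f (suc (suc k)) flips odd = begin
  f (suc (suc k))     ≡⟨ flips (suc k) ≤-refl ⟩
  not (f (suc k))     ≡⟨ cong not (flips k (m<n⇒m<1+n (n<1+n k))) ⟩
  not (not (f k))     ≡⟨ not-involutive (f k) ⟩
  f k                 ≡⟨ flip-odd f k (λ a a<k → flips a (m<n⇒m<1+n (m<n⇒m<1+n a<k))) odd ⟩
  not (f 0)           ∎
  where open ≡-Reasoning

gap-pos : ∀ {a s} → a < a + s → 0 < s
gap-pos {a} {zero}  a<a = contradiction (subst (a <_) (+-identityʳ a) a<a) (<-irrefl refl)
gap-pos {s = suc s} _   = s≤s z≤n

summand< : ∀ a {s k} → a + s < k → s < k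
summand< a {s} a+s<k = ≤-<-trans (m≤n+m s a) a+s<k

∸-step : ∀ {i k} → i < k → k ∸ i ≡ suc (k ∸ suc i)
∸-step {zero}  {suc k} _         = refl
∸-step {suc i} {suc k} (s≤s i<k) = ∸-step i<k

∸-back : ∀ {i k} → i < k → k ∸ suc (k ∸ suc i) ≡ i
∸-back {i} {k} i<k = trans (cong (k ∸_) (sym (∸-step i<k))) (m∸[m∸n]≡n (<⇒≤ i<k))

⟪_⟫ : ∀ {m} {P : Pred (Fin m) 0ℓ} → Decidable P → Subset m
⟪ P? ⟫ = tabulate (λ x → does (P? x))

∈⟪⟫⁺ : ∀ {m} {P : Pred (Fin m) 0ℓ} (P? : Decidable P) {x} → P x → x ∈ ⟪ P? ⟫
∈⟪⟫⁺ P? {x} px = lookup⇒[]= x _ (trans (lookup∘tabulate _ x) (dec-true (P? x) px))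

∈⟪⟫⁻ : ∀ {m} {P : Pred (Fin m) 0ℓ} (P? : Decidable P) {x} → x ∈ ⟪ P? ⟫ → P x
∈⟪⟫⁻ P? {x} x∈ = witness (P? x) (trans (sym (lookup∘tabulate _ x)) ([]=⇒lookup x∈))
  where
  witness : ∀ {Q : Set} (d : Dec Q) → does d ≡ true → Q
  witness (yes q) _ = q
  witness (no _)  ()

missing⇒⊂ : ∀ {m} {X : Subset m} {z} → z ∉ X → X ⊂ ⊤
missing⇒⊂ z∉ = ⊆⊤ , _ , ∈⊤ , z∉

module Walks (D : Digraph) where

  V : Set
  V = Fin (n D)

  infixr 5 _∷_
  data Walk : V → V → ℕ → Set where
    []  : ∀ {x} → Walk x x 0
    _∷_ : ∀ {x y z ℓ} → Arc D x y → Walk y z ℓ → Walk x z (suc ℓ)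

  infixr 5 _++_
  _++_ : ∀ {x y z ℓ m} → Walk x y ℓ → Walk y z m → Walk x z (ℓ + m)
  []      ++ w = w
  (a ∷ v) ++ w = a ∷ (v ++ w)

  trace : (p : ℕ → V) (L : ℕ) → (∀ t → t < L → Arc D (p t) (p (suc t))) → Walk (p 0) (p L) L
  trace p zero    _     = []
  trace p (suc L) steps = steps 0 (s≤s z≤n) ∷ trace (λ t → p (suc t)) L (λ t t<L → steps (suc t) (s≤s t<L))

  OddShortcut : ℕ → Set
  OddShortcut k = ∃[ L ] (L < k × parity L ≡ 1ℙ × ∃[ x ] Walk x x L)

  -- A closed walk of length k, unrolled into a k-periodic sequence of vertices.
  record Loop (k : ℕ) : Set where
    field
      c        : ℕ → V
      periodic : ∀ t → c (k + t) ≡ c t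
      step     : ∀ t → Arc D (c t) (c (suc t))

  -- Unrolling the closed walk  x → y ⋯ x : `go v t` is the vertex reached
  -- after t steps along v, continuing along the whole walk at its end.
  module Unroll {x y ℓ} (e : Arc D x y) (w : Walk y x ℓ) where
    go : ∀ {u m} → Walk u x m → ℕ → V
    go {u} _ zero    = u
    go (a ∷ v) (suc t) = go v t
    go []      (suc t) = go w t

    go-step : ∀ {u m} (v : Walk u x m) t → Arc D (go v t) (go v (suc t))
    go-step (a ∷ v) zero    = a
    go-step (a ∷ v) (suc t) = go-step v t
    go-step []      zero    = e
    go-step []      (suc t) = go-step w t

    go-end : ∀ {u m} (v : Walk u x m) t → go v (m + t) ≡ go [] t
    go-end []      t = refl
    go-end (a ∷ v) t = go-end v t

    loop : Loop (suc ℓ)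
    loop = record { c = go (e ∷ w) ; periodic = periodic ; step = go-step (e ∷ w) }
      where
      -- go [] t and go (e ∷ w) t agree, but only after splitting on t
      periodic : ∀ t → go w (ℓ + t) ≡ go (e ∷ w) t
      periodic zero    = go-end w zero
      periodic (suc t) = go-end w (suc t)

  unroll : ∀ {x ℓ} → Walk x x (suc ℓ) → Loop (suc ℓ)
  unroll (e ∷ w) = Unroll.loop e w

  toLoop : ∀ {k x} → parity k ≡ 1ℙ → Walk x x k → Loop k
  toLoop {suc ℓ} _ w = unroll w

  toLoop-start : ∀ {k x} (odd : parity k ≡ 1ℙ) (w : Walk x x k) → Loop.c (toLoop odd w) 0 ≡ x
  toLoop-start {suc ℓ} _ (e ∷ w) = refl

  rotate : ∀ {k} → ℕ → Loop k → Loop k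
  rotate {k} j C = record { c = λ t → c (j + t) ; periodic = periodic′ ; step = step′ }
    where
    open Loop C
    periodic′ : ∀ t → c (j + (k + t)) ≡ c (j + t)
    periodic′ t = trans (cong c (x∙yz≈y∙xz j k t)) (periodic (j + t))
    step′ : ∀ t → Arc D (c (j + t)) (c (j + suc t))
    step′ t = subst (λ s → Arc D (c (j + t)) (c s)) (sym (+-suc j t)) (step (j + t))

  triangle : ∀ {a b d} → Arc D a b → Arc D b d → Arc D d a → Walk a a 3
  triangle ab bd da = ab ∷ bd ∷ da ∷ []

  triangle⇒shortcut : ∀ {k a b d} → Arc D a b → Arc D b d → Arc D d a → 3 < k → OddShortcut k
  triangle⇒shortcut ab bd da 3<k = 3 , 3<k , refl , _ , triangle ab bd da

  odd-length≥3 : ∀ {k} → parity k ≡ 1ℙ → Loop k → 3 ≤ k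
  odd-length≥3 {suc zero} _ C = contradiction (subst (Arc D (c 0)) (periodic 0) (step 0)) (loopless D (c 0))
    where open Loop C
  odd-length≥3 {suc (suc (suc k))} _ _ = s≤s (s≤s (s≤s z≤n))

  Apart : ∀ {k} → Loop k → Set
  Apart {k} C = ∀ x e → 0 < e → e < k → Loop.c C x ≢ Loop.c C (e + x)

  rotate-apart : ∀ {k} j (C : Loop k) → Apart C → Apart (rotate j C)
  rotate-apart j C apart x e e>0 e<k eq =
    apart (j + x) e e>0 e<k (trans eq (cong (Loop.c C) (x∙yz≈y∙xz j e x)))

  module LoopProperties {k : ℕ} (C : Loop k) where
    open Loop C

    wrap : c k ≡ c 0
    wrap = trans (cong c (sym (+-identityʳ k))) (periodic 0)

    periodic-* : ∀ q t → c (q * k + t) ≡ c t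
    periodic-* zero    t = refl
    periodic-* (suc q) t = trans (cong c (+-assoc k (q * k) t)) (trans (periodic (q * k + t)) (periodic-* q t))

    segment : ∀ i L → Walk (c i) (c (L + i)) L
    segment i L = trace (λ t → c (t + i)) L (λ t _ → step (t + i))

    closedSegment : ∀ i L → c (L + i) ≡ c i → Walk (c i) (c i) L
    closedSegment i L returns = subst (λ y → Walk (c i) y L) returns (segment i L)

    reduce : 0 < k → ∀ x → ∃[ r ] (r < k × ∀ t → c (t + x) ≡ c (t + r))
    reduce k>0 x = x % k , m%n<n x k , shift
      where
      instance
        k≢0 : NonZero k
        k≢0 = >-nonZero k>0
      shift : ∀ t → c (t + x) ≡ c (t + x % k)
      shift t = begin
        c (t + x)                       ≡⟨ cong (λ y → c (t + y)) (m≡m%n+[m/n]*n x k) ⟩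
        c (t + (x % k + x / k * k))     ≡⟨ cong c (rearrange t (x % k) (x / k * k)) ⟩
        c (x / k * k + (t + x % k))     ≡⟨ periodic-* (x / k) (t + x % k) ⟩
        c (t + x % k)                   ∎
        where
        open ≡-Reasoning
        rearrange : ∀ t r q → t + (r + q) ≡ q + (t + r)
        rearrange = solve-∀

    offset : ∀ {a b} → a < k → b < k → ∃[ e ] (e < k × c b ≡ c (a + e))
    offset {a} {b} a<k b<k with a ≤? b
    ... | yes a≤b = b ∸ a , ≤-<-trans (m∸n≤m b a) b<k , cong c (sym (m+[n∸m]≡n a≤b))
    ... | no  a≰b = (k ∸ a) + b , subst ((k ∸ a) + b <_) (m∸n+n≡m (<⇒≤ a<k)) (+-monoʳ-< (k ∸ a) b<a′) , sym (trans (cong c around) (periodic b))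
      where
      b<a′ : b < a
      b<a′ = ≰⇒> a≰b
      around : a + ((k ∸ a) + b) ≡ k + b
      around = trans (sym (+-assoc a (k ∸ a) b)) (cong (_+ b) (m+[n∸m]≡n (<⇒≤ a<k)))

    window⇒apart : 0 < k → (∀ a b → a < b → b < k → c a ≢ c b) → Apart C
    window⇒apart k>0 inj x e e>0 e<k eq with reduce k>0 x
    ... | r , r<k , shift = coincide (trans (sym (shift 0)) (trans eq (shift e)))
      where
      coincide : c r ≢ c (e + r)
      coincide eq′ with e + r <? k
      ... | yes e+r<k = inj r (e + r) (m<n+m r e>0) e+r<k eq′
      ... | no  e+r≮k with s , k+s≡ ← m≤n⇒∃[o]m+o≡n (≮⇒≥ e+r≮k) =
        inj s r s<r r<k (sym (trans eq′ (trans (cong c (sym k+s≡)) (periodic s))))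
        where
        s<r : s < r
        s<r = +-cancelˡ-< k s r (subst (_< k + r) (sym k+s≡) (+-monoˡ-< r e<k))

    apart⇒injective : Apart C → ∀ {a b} → a < k → b < k → c a ≡ c b → a ≡ b
    apart⇒injective apart {a} {b} a<k b<k eq with <-cmp a b
    ... | tri≈ _ a≡b _ = a≡b
    ... | tri< a<b _ _ with s , refl ← m≤n⇒∃[o]m+o≡n (<⇒≤ a<b) =
      contradiction (trans eq (cong c (+-comm a s))) (apart a s (gap-pos a<b) (summand< a b<k))
    ... | tri> _ _ b<a with s , refl ← m≤n⇒∃[o]m+o≡n (<⇒≤ b<a) =
      contradiction (trans (sym eq) (cong c (+-comm b s))) (apart b s (gap-pos b<a) (summand< b a<k))

    module Odd (odd : parity k ≡ 1ℙ) where

      -- a repeated vertex splits the loop into two closed walks, one of them odd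
      repeat⇒shortcut : ∀ {a b} → a < b → b < k → c a ≡ c b → OddShortcut k
      repeat⇒shortcut {a} {b} a<b b<k ca≡cb
        with s , refl ← m≤n⇒∃[o]m+o≡n (<⇒≤ a<b) | r , a+s+r≡k ← m≤n⇒∃[o]m+o≡n (<⇒≤ b<k) =
        choose (odd-summand s (r + a) (trans (cong parity total) odd))
        where
        total : s + (r + a) ≡ k
        total = trans (rearrange a s r) a+s+r≡k
          where rearrange : ∀ a s r → s + (r + a) ≡ a + s + r
                rearrange = solve-∀
        around : r + a + (a + s) ≡ k + a
        around = trans (rearrange r a s) (cong (_+ a) a+s+r≡k)
          where rearrange : ∀ r a s → r + a + (a + s) ≡ a + s + r + a
                rearrange = solve-∀
        choose : parity s ≡ 1ℙ ⊎ parity (r + a) ≡ 1ℙ → OddShortcut k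
        choose (inj₁ odd-s) = s , summand< a b<k , odd-s , c a ,
          closedSegment a s (trans (cong c (+-comm s a)) (sym ca≡cb))
        choose (inj₂ odd-r) = r + a , subst (r + a <_) total (m<n+m (r + a) (gap-pos a<b)) , odd-r , c (a + s) ,
          closedSegment (a + s) (r + a) (trans (cong c around) (trans (periodic a) ca≡cb))

      oddChord⇒shortcut : ∀ {d} → Arc D (c 0) (c d) → 2 ≤ d → d < k → parity d ≡ 1ℙ → OddShortcut k
      oddChord⇒shortcut {d} chord 2≤d d<k odd-d with s , d+s≡k ← m≤n⇒∃[o]m+o≡n (<⇒≤ d<k) =
        suc s , subst (suc s <_) d+s≡k (+-monoˡ-≤ s 2≤d) , odd-suc-s , c 0 ,
        chord ∷ subst (λ y → Walk (c d) y s) (trans (cong c (trans (+-comm s d) d+s≡k)) wrap) (segment d s)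
        where
        open ≡-Reasoning
        odd-suc-s : parity (suc s) ≡ 1ℙ
        odd-suc-s = begin
          parity (suc s)          ≡⟨ parity-suc s ⟩
          parity s ⁻¹             ≡⟨ cong (_+ᴾ parity s) (sym odd-d) ⟩
          parity d +ᴾ parity s    ≡⟨ sym (ℙ.+-homo-+ d s) ⟩
          parity (d + s)          ≡⟨ cong parity d+s≡k ⟩
          parity k                ≡⟨ odd ⟩
          1ℙ                      ∎

      backChord⇒shortcut : ∀ {e} → Arc D (c e) (c 0) → 2 + e ≤ k → parity e ≡ 0ℙ → OddShortcut k
      backChord⇒shortcut {e} chord 2+e≤k even-e =
        suc e , 2+e≤k , trans (parity-suc e) (cong _⁻¹ even-e) , c e ,
        chord ∷ subst (λ y → Walk (c 0) y e) (cong c (+-identityʳ e)) (segment 0 e)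

module InducedLoops (D : Digraph) where
  open Walks D

  Induced : ∀ {k} → Loop k → Set
  Induced C = ∀ a b → Arc D (c a) (c b) → c b ≡ c (suc a)
    where open Loop C

  Spanning : ∀ {k} → Loop k → Set
  Spanning {k} C = ∀ z → ∃[ a ] (a < k × Loop.c C a ≡ z)

  rotate-induced : ∀ {k} j (C : Loop k) → Induced C → Induced (rotate j C)
  rotate-induced j C induced a b arc = trans (induced (j + a) (j + b) arc) (cong (Loop.c C) (sym (+-suc j a)))

  module InducedProperties {k} (C : Loop k) where
    open Loop C
    open LoopProperties C

    window⇒induced : 0 < k → (∀ a b → a < k → b < k → Arc D (c a) (c b) → c b ≡ c (suc a)) → Induced C
    window⇒induced k>0 induced a b arc with reduce k>0 a | reduce k>0 b
    ... | r , r<k , shift-a | s , s<k , shift-b =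
      trans (shift-b 0) (trans (induced r s r<k s<k (subst₂ (Arc D) (shift-a 0) (shift-b 0) arc)) (sym (shift-a 1)))

    rotate-spanning : 0 < k → Spanning C → ∀ j → Spanning (rotate j C)
    rotate-spanning k>0 spanning j z with spanning z
    ... | a , _ , ca≡z with reduce k>0 (a + j * pred k)
    ...   | r , r<k , shift = r , r<k , trans (sym (shift j)) (trans (cong c around) (trans (periodic-* j a) ca≡z))
      where
      instance
        k≢0 : NonZero k
        k≢0 = >-nonZero k>0
      open ≡-Reasoning
      around : j + (a + j * pred k) ≡ j * k + a
      around = begin
        j + (a + j * pred k)    ≡⟨ x∙yz≈y∙xz j a _ ⟩
        a + (j + j * pred k)    ≡⟨ cong (a +_) (sym (*-suc j (pred k))) ⟩
        a + j * suc (pred k)    ≡⟨ cong (λ m → a + j * m) (suc-pred k) ⟩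
        a + j * k               ≡⟨ +-comm a (j * k) ⟩
        j * k + a               ∎

    -- Along an induced odd loop, kernel membership would have to alternate,
    -- which is impossible after an odd number of steps.
    no-kernel : parity k ≡ 1ℙ → Induced C → ∀ {X K} → (∀ a → c a ∈ X) → (∀ y → y ∈ X → ∃[ b ] c b ≡ y)
              → ¬ IsKernelIn D X K
    no-kernel odd induced {X} {K} onX fromX (K⊆X , independent , absorbent) =
      not-¬ (cong (λ v → does (v ∈? K)) wrap) (flip-odd inK k flips odd)
      where
      inK : ℕ → Bool
      inK a = does (c a ∈? K)
      flips : ∀ a → a < k → inK (suc a) ≡ not (inK a)
      flips a _ with c a ∈? K | c (suc a) ∈? K
      ... | yes a∈K | yes sa∈K = contradiction (step a) (independent _ _ a∈K sa∈K)
      ... | yes _   | no _     = refl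
      ... | no _    | yes _    = refl
      ... | no a∉K  | no sa∉K with absorbent (c a) (onX a) a∉K
      ...   | y , y∈K , arc with fromX y (K⊆X y∈K)
      ...     | b , refl = contradiction (subst (_∈ K) (induced a b arc) y∈K) sa∉K

  module SpanningLoop {k} (C : Loop k) (apart : Apart C) (induced : Induced C) (spanning : Spanning C) where
    open Loop C
    open LoopProperties C

    index : V → ℕ
    index z = proj₁ (spanning z)

    index<k : ∀ z → index z < k
    index<k z = proj₁ (proj₂ (spanning z))

    at-index : ∀ z → c (index z) ≡ z
    at-index z = proj₂ (proj₂ (spanning z))

    index-at : ∀ {a} → a < k → index (c a) ≡ a
    index-at a<k = apart⇒injective apart (index<k _) a<k (at-index _)

    Next : ℕ → ℕ → Set
    Next a b = (b ≡ suc a) ⊎ (suc a ≡ k × b ≡ 0)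

    follows : ∀ {a b} → a < k → b < k → c b ≡ c (suc a) → Next a b
    follows {a} {b} a<k b<k eq with suc a <? k
    ... | yes sa<k = inj₁ (apart⇒injective apart b<k sa<k eq)
    ... | no  sa≮k = inj₂ (sa≡k , apart⇒injective apart b<k (≤-trans (s≤s z≤n) a<k) (trans eq (trans (cong c sa≡k) wrap)))
      where
      sa≡k : suc a ≡ k
      sa≡k = ≤-antisym a<k (≮⇒≥ sa≮k)

    arc⇒next : ∀ {u v} → Arc D u v → Next (index u) (index v)
    arc⇒next {u} {v} arc = follows (index<k u) (index<k v)
      (induced (index u) (index v) (subst₂ (Arc D) (sym (at-index u)) (sym (at-index v)) arc))

    next⇒arc : ∀ {u v} → Next (index u) (index v) → Arc D u v
    next⇒arc {u} {v} next = subst₂ (Arc D) (at-index u) (trans (sym (c-next next)) (at-index v)) (step (index u))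
      where
      c-next : Next (index u) (index v) → c (index v) ≡ c (suc (index u))
      c-next (inj₁ e)        = cong c e
      c-next (inj₂ (e , e₀)) = trans (cong c e₀) (trans (sym wrap) (cong c (sym e)))

    k≡n : k ≡ n D
    k≡n = ≤-antisym (injective⇒≤ {f = λ i → c (toℕ i)} position-injective) (injective⇒≤ {f = λ z → fromℕ< (index<k z)} index-injective)
      where
      position-injective : ∀ {i j : Fin k} → c (toℕ i) ≡ c (toℕ j) → i ≡ j
      position-injective eq = toℕ-injective (apart⇒injective apart (toℕ<n _) (toℕ<n _) eq)
      index-injective : ∀ {y z} → fromℕ< (index<k y) ≡ fromℕ< (index<k z) → y ≡ z
      index-injective {y} {z} eq = trans (sym (at-index y))
        (trans (cong c (trans (sym (toℕ-fromℕ< _)) (trans (cong toℕ eq) (toℕ-fromℕ< _)))) (at-index z))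

    σ : V → V
    σ z = fromℕ< (subst (index z <_) k≡n (index<k z))

    toℕ-σ : ∀ z → toℕ (σ z) ≡ index z
    toℕ-σ z = toℕ-fromℕ< _

    σ-bijection : V ⤖ V
    σ-bijection = mk⤖ {to = σ} (injective , surjective)
      where
      injective : ∀ {y z} → σ y ≡ σ z → y ≡ z
      injective {y} {z} eq = trans (sym (at-index y))
        (trans (cong c (trans (sym (toℕ-σ y)) (trans (cong toℕ eq) (toℕ-σ z)))) (at-index z))
      surjective : ∀ i → ∃ λ z → ∀ {y} → y ≡ z → σ y ≡ i
      surjective i = c (toℕ i) , λ { refl → toℕ-injective
        (trans (toℕ-σ _) (index-at (subst (toℕ i <_) (sym k≡n) (toℕ<n i)))) }

    next⇔cycSucc : ∀ u v → Next (index u) (index v) ⇔ CycSucc (σ u) (σ v)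
    next⇔cycSucc u v = mk⇔ to from
      where
      to : Next (index u) (index v) → CycSucc (σ u) (σ v)
      to (inj₁ e)        = inj₁ (trans (cong suc (toℕ-σ u)) (trans (sym e) (sym (toℕ-σ v))))
      to (inj₂ (e , e₀)) = inj₂ (trans (cong suc (toℕ-σ u)) (trans e k≡n) , trans (toℕ-σ v) e₀)
      from : CycSucc (σ u) (σ v) → Next (index u) (index v)
      from (inj₁ e)        = inj₁ (trans (sym (toℕ-σ v)) (trans (sym e) (cong suc (toℕ-σ u))))
      from (inj₂ (e , e₀)) = inj₂ (trans (cong suc (sym (toℕ-σ u))) (trans e (sym k≡n)) , trans (sym (toℕ-σ v)) e₀)

    isDirectedCycle : 3 ≤ k → IsDirectedCycle D
    isDirectedCycle 3≤k = subst (3 ≤_) k≡n 3≤k , σ-bijection ,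
      λ u v → mk⇔ (λ arc → Equivalence.to (next⇔cycSucc u v) (arc⇒next arc))
                  (λ cs → next⇒arc (Equivalence.from (next⇔cycSucc u v) cs))

    -- A subdigraph D[X] missing c₀ lies inside the path c₁ → ⋯ → c_{k-1};
    -- its kernel is chosen greedily, walking back from the end of the path.
    module PathKernel (X : Subset (n D)) (c₀∉X : c 0 ∉ X) where
      -- whether the vertex s steps before position k is chosen
      chosen : ℕ → Bool
      chosen zero    = false
      chosen (suc s) = does (c (k ∸ suc s) ∈? X) ∧ not (chosen s)

      Chosen : ℕ → Set
      Chosen i = chosen (k ∸ i) ≡ true

      chosen-spec : ∀ {i} → i < k → Chosen i ⇔ (c i ∈ X × ¬ Chosen (suc i))
      chosen-spec {i} i<k rewrite ∸-step i<k | ∸-back i<k = mk⇔ to from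
        where
        to : does (c i ∈? X) ∧ not (chosen (k ∸ suc i)) ≡ true → c i ∈ X × ¬ Chosen (suc i)
        to eq with c i ∈? X | chosen (k ∸ suc i)
        ... | yes i∈X | false = i∈X , λ ()
        from : c i ∈ X × ¬ Chosen (suc i) → does (c i ∈? X) ∧ not (chosen (k ∸ suc i)) ≡ true
        from (i∈X , not-next) with c i ∈? X | chosen (k ∸ suc i)
        ... | yes _   | false = refl
        ... | yes _   | true  = contradiction refl not-next
        ... | no i∉X  | _     = contradiction i∈X i∉X

      chosen? : ∀ y → Dec (Chosen (index y))
      chosen? y = chosen (k ∸ index y) ≟ᴮ true

      K : Subset (n D)
      K = ⟪ chosen? ⟫

      K⊆X : K ⊆ X
      K⊆X {y} y∈K = subst (_∈ X) (at-index y)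
        (proj₁ (Equivalence.to (chosen-spec (index<k y)) (∈⟪⟫⁻ chosen? y∈K)))

      independent : ∀ x y → x ∈ K → y ∈ K → ¬ Arc D x y
      independent x y x∈K y∈K arc with arc⇒next arc
      ... | inj₁ e = proj₂ (Equivalence.to (chosen-spec (index<k x)) (∈⟪⟫⁻ chosen? x∈K))
                       (subst Chosen e (∈⟪⟫⁻ chosen? y∈K))
      ... | inj₂ (_ , e₀) = c₀∉X (subst (_∈ X) (trans (sym (at-index y)) (cong c e₀)) (K⊆X y∈K))

      absorbent : ∀ y → y ∈ X → y ∉ K → ∃[ t ] (t ∈ K × Arc D y t)
      absorbent y y∈X y∉K = c (suc i) , ∈⟪⟫⁺ chosen? next-chosen′ , subst (λ v → Arc D v (c (suc i))) (at-index y) (step i)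
        where
        i : ℕ
        i = index y
        next-chosen : Chosen (suc i)
        next-chosen with chosen (k ∸ suc i) ≟ᴮ true
        ... | yes chosen-next = chosen-next
        ... | no not-next = contradiction (∈⟪⟫⁺ chosen? (Equivalence.from (chosen-spec (index<k y))
                              (subst (_∈ X) (sym (at-index y)) y∈X , not-next))) y∉K
        si<k : suc i < k
        si<k with m≤n⇒m<n∨m≡n (index<k y)
        ... | inj₁ si<k = si<k
        ... | inj₂ si≡k with () ← trans (sym next-chosen) (cong chosen (trans (cong (k ∸_) si≡k) (n∸n≡0 k)))
        next-chosen′ : chosen (k ∸ index (c (suc i))) ≡ true
        next-chosen′ = subst Chosen (sym (index-at si<k)) next-chosen

      kernel : HasKernelIn D X
      kernel = K , K⊆X , independent , absorbent

  -- An apart, induced, spanning loop of odd length makes D kernel-critical: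
  -- D itself has no kernel, and a proper induced subdigraph misses some
  -- vertex, at which the loop may be started to apply the path kernel.
  odd-spanning-loop⇒CKI : ∀ {k} → parity k ≡ 1ℙ → (C : Loop k) → Apart C → Induced C → Spanning C → CKI D
  odd-spanning-loop⇒CKI {k} odd C apart induced spanning = no-kernel-D , proper-kernel
    where
    open Loop C
    k>0 : 0 < k
    k>0 = odd⇒pos odd
    no-kernel-D : ¬ HasKernel D
    no-kernel-D (K , kernel) = InducedProperties.no-kernel C odd induced (λ _ → ∈⊤)
      (λ y _ → let (b , _ , cb≡y) = spanning y in b , cb≡y) kernel
    proper-kernel : ∀ X → X ⊂ ⊤ → HasKernelIn D X
    proper-kernel X (_ , z , _ , z∉X) with spanning z
    ... | a , _ , ca≡z = PathKernel.kernel X (λ c₀∈X → z∉X (subst (_∈ X) (trans (cong c (+-identityʳ a)) ca≡z) c₀∈X))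
      where
      open SpanningLoop (rotate a C) (rotate-apart a C apart) (rotate-induced a C induced)
                        (InducedProperties.rotate-spanning C k>0 spanning a)

module EvenChords (D : Digraph) where
  open Walks D

  LoopArc : ∀ {k} → Loop k → ℕ → ℕ → Set
  LoopArc C i j = Arc D (Loop.c C i) (Loop.c C j)

  -- The class-specific step of the proof: in an apart loop of odd length k,
  -- a chord from position 0 across an even number 2 + 2m of steps, leaving
  -- at least two more steps to close the loop, yields an odd shortcut.
  EvenChordHandler : ℕ → Set
  EvenChordHandler k = (C : Loop k) → Apart C → ∀ m
    → LoopArc C 0 (2 + twice m) → 4 + twice m ≤ k → OddShortcut k

  HandlersUpTo : ℕ → Set
  HandlersUpTo L = ∀ {j} → j ≤ L → parity j ≡ 1ℙ → EvenChordHandler j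

  odd⇒5≤ : ∀ {k} → parity k ≡ 1ℙ → 4 ≤ k → 5 ≤ k
  odd⇒5≤ {k} odd 4≤k with m≤n⇒m<n∨m≡n 4≤k
  ... | inj₁ 4<k = 4<k
  ... | inj₂ refl with () ← odd

  module Window {k} (C : Loop k) (apart : Apart C) where
    open Loop C

    pos≢ : ∀ {i j} → i < k → j < k → i ≢ j → c i ≢ c j
    pos≢ i<k j<k i≢j eq = i≢j (LoopProperties.apart⇒injective C apart i<k j<k eq)

    distinct4 : ∀ {i j l m} → i < k → j < k → l < k → m < k
              → i ≢ j → i ≢ l → i ≢ m → j ≢ l → j ≢ m → l ≢ m
              → Distinct4 (c i) (c j) (c l) (c m)
    distinct4 i<k j<k l<k m<k i≢j i≢l i≢m j≢l j≢m l≢m =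
      pos≢ i<k j<k i≢j , pos≢ i<k l<k i≢l , pos≢ i<k m<k i≢m ,
      pos≢ j<k l<k j≢l , pos≢ j<k m<k j≢m , pos≢ l<k m<k l≢m

  small< : ∀ {k} → 5 ≤ k → ∀ i {_ : T (i <ᵇ 5)} → i < k
  small< 5≤k i {p} = <-≤-trans (<ᵇ⇒< i 5 p) 5≤k

  low< : ∀ {k} t → 6 + t ≤ k → ∀ i {_ : T (i <ᵇ 6)} → i < k
  low< t 6+t≤k i {p} = <-≤-trans (<ᵇ⇒< i 6 p) (≤-trans (m≤m+n 6 t) 6+t≤k)

  high< : ∀ {k} t → 6 + t ≤ k → ∀ i {_ : T (i <ᵇ 6)} → i + t < k
  high< t 6+t≤k i {p} = <-≤-trans (+-monoˡ-< t (<ᵇ⇒< i 6 p)) 6+t≤k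

  shifted≢ : ∀ t {i j} → i ≢ j → i + t ≢ j + t
  shifted≢ t i≢j eq = i≢j (+-cancelʳ-≡ t _ _ eq)

  infixl 1 _▷_
  _▷_ : ∀ {A : Set} {k} → A ⊎ OddShortcut k → (A → OddShortcut k) → OddShortcut k
  inj₁ a ▷ continue = continue a
  inj₂ s ▷ _        = s

  module Shortcuts {k} (odd : parity k ≡ 1ℙ) where
    backChord : (C : Loop k) → ∀ {e} → LoopArc C e 0 → 2 + e ≤ k → parity e ≡ 0ℙ → OddShortcut k
    backChord C = LoopProperties.Odd.backChord⇒shortcut C odd

    oddChord : (C : Loop k) → ∀ {d} → LoopArc C 0 d → 2 ≤ d → d < k → parity d ≡ 1ℙ → OddShortcut k
    oddChord C = LoopProperties.Odd.oddChord⇒shortcut C odd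

  -- A chord c₀ → c_{4+t} is shortened to
  -- c₂ → c_{4+t} (or reversed into a shortcut); a two-step chord propagates
  -- forward until two consecutive ones close a short odd cycle.
  module ArcLocallyOut (alos : ArcLocallyOutSemicomplete D) {k} (odd : parity k ≡ 1ℙ) where
    open Shortcuts {k} odd

    propagate : (C : Loop k) → Apart C → 5 ≤ k → LoopArc C 0 2 → LoopArc C 1 3 ⊎ OddShortcut k
    propagate C apart 5≤k a02 =
      conclude (alos (c 3) (c 2) (c 0) (c 1)
        (distinct4 (w 3) (w 2) (w 0) (w 1) (λ ()) (λ ()) (λ ()) (λ ()) (λ ()) (λ ()))
        (step 2) a02 (step 0))
      where
      open Loop C
      open Window C apart
      w : ∀ i {_ : T (i <ᵇ 5)} → i < k
      w = small< 5≤k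
      conclude : Adjacent D (c 3) (c 1) → LoopArc C 1 3 ⊎ OddShortcut k
      conclude (inj₁ a31) = inj₂ (backChord (rotate 1 C) a31 (<⇒≤ (w 4)) refl)
      conclude (inj₂ a13) = inj₁ a13

    twoChords : (C : Loop k) → Apart C → 5 ≤ k → LoopArc C 0 2 → LoopArc C 2 4 → OddShortcut k
    twoChords C apart 5≤k a02 a24 =
      conclude (alos (c 4) (c 2) (c 0) (c 1)
        (distinct4 (w 4) (w 2) (w 0) (w 1) (λ ()) (λ ()) (λ ()) (λ ()) (λ ()) (λ ()))
        a24 a02 (step 0))
      where
      open Loop C
      open Window C apart
      w : ∀ i {_ : T (i <ᵇ 5)} → i < k
      w = small< 5≤k
      conclude : Adjacent D (c 4) (c 1) → OddShortcut k
      conclude (inj₁ a41) = triangle⇒shortcut (step 1) a24 a41 (w 3)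
      conclude (inj₂ a14) = oddChord (rotate 1 C) a14 (s≤s (s≤s z≤n)) (w 3) refl

    handler : EvenChordHandler k
    handler C apart zero a02 4≤k =
      propagate C apart 5≤k a02 ▷ λ a13 →
      propagate (rotate 1 C) (rotate-apart 1 C apart) 5≤k a13 ▷ λ a24 →
      twoChords C apart 5≤k a02 a24
      where
      5≤k : 5 ≤ k
      5≤k = odd⇒5≤ odd 4≤k
    handler C apart (suc m) a0x 6+t≤k =
      conclude (alos (c 2) (c 1) (c 0) (c (4 + t))
        (distinct4 (low< t 6+t≤k 2) (low< t 6+t≤k 1) (low< t 6+t≤k 0) (high< t 6+t≤k 4)
          (λ ()) (λ ()) (λ ()) (λ ()) (λ ()) (λ ()))
        (step 1) (step 0) a0x)
      where
      open Loop C
      open Window C apart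
      t : ℕ
      t = twice m
      conclude : Adjacent D (c 2) (c (4 + t)) → OddShortcut k
      conclude (inj₁ a2x) = handler (rotate 2 C) (rotate-apart 2 C apart) m a2x (m+n≤o⇒n≤o 2 6+t≤k)
      conclude (inj₂ ax2) = backChord (rotate 2 C) ax2 (m+n≤o⇒n≤o 2 6+t≤k) (parity-twice m)

  -- A chord c₀ → c_{4+t} is shortened to
  -- c₀ → c_{2+t}; two-step chords propagate backward.
  module ArcLocallyIn (alis : ArcLocallyInSemicomplete D) {k} (odd : parity k ≡ 1ℙ) where
    open Shortcuts {k} odd

    propagate : (C : Loop k) → Apart C → 5 ≤ k → LoopArc C 1 3 → LoopArc C 0 2 ⊎ OddShortcut k
    propagate C apart 5≤k a13 =
      conclude (alis (c 2) (c 3) (c 1) (c 0)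
        (distinct4 (w 2) (w 3) (w 1) (w 0) (λ ()) (λ ()) (λ ()) (λ ()) (λ ()) (λ ()))
        (step 2) a13 (step 0))
      where
      open Loop C
      open Window C apart
      w : ∀ i {_ : T (i <ᵇ 5)} → i < k
      w = small< 5≤k
      conclude : Adjacent D (c 2) (c 0) → LoopArc C 0 2 ⊎ OddShortcut k
      conclude (inj₁ a20) = inj₂ (backChord C a20 (<⇒≤ (w 4)) refl)
      conclude (inj₂ a02) = inj₁ a02

    twoChords : (C : Loop k) → Apart C → 5 ≤ k → LoopArc C 0 2 → LoopArc C 2 4 → OddShortcut k
    twoChords C apart 5≤k a02 a24 =
      conclude (alis (c 3) (c 4) (c 2) (c 0)
        (distinct4 (w 3) (w 4) (w 2) (w 0) (λ ()) (λ ()) (λ ()) (λ ()) (λ ()) (λ ()))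
        (step 3) a24 a02)
      where
      open Loop C
      open Window C apart
      w : ∀ i {_ : T (i <ᵇ 5)} → i < k
      w = small< 5≤k
      conclude : Adjacent D (c 3) (c 0) → OddShortcut k
      conclude (inj₁ a30) = triangle⇒shortcut a02 (step 2) a30 (w 3)
      conclude (inj₂ a03) = oddChord C a03 (s≤s (s≤s z≤n)) (w 3) refl

    -- The chord is moved to position 2 of the loop started two steps
    -- earlier, then propagated back to positions 1 and 0.
    handler : EvenChordHandler k
    handler C apart zero a02 4≤k with j , 2+j≡k ← m≤n⇒∃[o]m+o≡n (≤-trans (s≤s (s≤s z≤n)) 4≤k) =
      propagate (rotate 1 C′) (rotate-apart 1 C′ apart′) 5≤k a24′ ▷ λ a13′ →
      propagate C′ apart′ 5≤k a13′ ▷ λ a02′ →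
      twoChords C′ apart′ 5≤k a02′ a24′
      where
      open Loop C
      open LoopProperties C using (wrap)
      5≤k : 5 ≤ k
      5≤k = odd⇒5≤ odd 4≤k
      C′ : Loop k
      C′ = rotate j C
      apart′ : Apart C′
      apart′ = rotate-apart j C apart
      a24′ : LoopArc C′ 2 4
      a24′ = subst₂ (Arc D) (sym at2) (sym at4) a02
        where
        at2 : c (j + 2) ≡ c 0
        at2 = trans (cong c (trans (+-comm j 2) 2+j≡k)) wrap
        at4 : c (j + 4) ≡ c 2
        at4 = trans (cong c (trans (+-comm j 4) (trans (cong (2 +_) 2+j≡k) (+-comm 2 k)))) (periodic 2)
    handler C apart (suc m) a0x 6+t≤k =
      conclude (alis (c 0) (c (4 + t)) (c (3 + t)) (c (2 + t))
        (distinct4 (low< t 6+t≤k 0) (high< t 6+t≤k 4) (high< t 6+t≤k 3) (high< t 6+t≤k 2)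
          (λ ()) (λ ()) (λ ()) (shifted≢ t λ ()) (shifted≢ t λ ()) (shifted≢ t λ ()))
        a0x (step (3 + t)) (step (2 + t)))
      where
      open Loop C
      open Window C apart
      t : ℕ
      t = twice m
      conclude : Adjacent D (c 0) (c (2 + t)) → OddShortcut k
      conclude (inj₁ a0y) = handler C apart m a0y (m+n≤o⇒n≤o 2 6+t≤k)
      conclude (inj₂ ay0) = backChord C ay0 (m+n≤o⇒n≤o 2 6+t≤k) (parity-twice m)

  module AntiQuasiTransitive (asym : Asymmetric D) (aqt : ThreeAntiQuasiTransitive D) (tt3 : TT3Free D)
                             {k} (odd : parity k ≡ 1ℙ) where
    open Shortcuts {k} odd

    -- A two-step chord c₀ → c₂ would induce TT₃ on c₀ c₁ c₂; a longer
    -- chord c₀ → c_{4+t} is shortened to c₁ → c_{3+t} by the anti-directed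
    -- path c₁ ← c₀ → c_{4+t} ← c_{3+t}.
    handler : EvenChordHandler k
    handler C apart zero a02 4≤k =
      contradiction (pos≢ (w 0) (w 1) (λ ()) , pos≢ (w 0) (w 2) (λ ()) , pos≢ (w 1) (w 2) (λ ()) ,
                     step 0 , step 1 , a02 , asym _ _ (step 0) , asym _ _ (step 1) , asym _ _ a02)
                    (tt3 (c 0) (c 1) (c 2))
      where
      open Loop C
      open Window C apart
      w : ∀ i {_ : T (i <ᵇ 5)} → i < k
      w = small< (odd⇒5≤ odd 4≤k)
    handler C apart (suc m) a0x 6+t≤k =
      conclude (aqt (c 1) (c 0) (c (4 + t)) (c (3 + t))
        (distinct4 (low< t 6+t≤k 1) (low< t 6+t≤k 0) (high< t 6+t≤k 4) (high< t 6+t≤k 3)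
          (λ ()) (λ ()) (λ ()) (λ ()) (λ ()) (shifted≢ t λ ()))
        (inj₂ (step 0 , a0x , step (3 + t))))
      where
      open Loop C
      open Window C apart
      t : ℕ
      t = twice m
      conclude : Adjacent D (c 1) (c (3 + t)) → OddShortcut k
      conclude (inj₁ a1y) = handler (rotate 1 C) (rotate-apart 1 C apart) m a1y (m+n≤o⇒n≤o 2 6+t≤k)
      conclude (inj₂ ay1) = backChord (rotate 1 C) ay1 (m+n≤o⇒n≤o 2 6+t≤k) (parity-twice m)

  class-handler : Asymmetric D
    → ArcLocallyInSemicomplete D ⊎ ArcLocallyOutSemicomplete D ⊎ (ThreeAntiQuasiTransitive D × TT3Free D)
    → ∀ {k} → parity k ≡ 1ℙ → EvenChordHandler k
  class-handler _    (inj₁ alis)               odd = ArcLocallyIn.handler alis odd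
  class-handler _    (inj₂ (inj₁ alos))        odd = ArcLocallyOut.handler alos odd
  class-handler asym (inj₂ (inj₂ (aqt , tt3))) odd = AntiQuasiTransitive.handler asym aqt tt3 odd

module OddLoops (D : Digraph) (asym : Asymmetric D) where
  open Walks D
  open EvenChords D
  open InducedLoops D

  module Analysis {k} (odd : parity k ≡ 1ℙ) (handler : EvenChordHandler k) where
    k>0 : 0 < k
    k>0 = odd⇒pos odd

    -- A chord from position 0 over e ≥ 2 steps yields a shortcut: directly
    -- when e is odd, by the handler when e is even and e ≤ k - 2, and when
    -- e = k - 1 it would reverse the last step of the loop.
    chord⇒shortcut : (C : Loop k) → Apart C → ∀ {e} → 2 ≤ e → e < k → LoopArc C 0 e → OddShortcut k
    chord⇒shortcut C apart {e} 2≤e e<k chord with parity e in parity-e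
    ... | 1ℙ = LoopProperties.Odd.oddChord⇒shortcut C odd chord 2≤e e<k parity-e
    ... | 0ℙ with even-form e parity-e 2≤e | 2 + e ≤? k
    ...   | m , refl | yes 2+e≤k = handler C apart m chord 2+e≤k
    ...   | _ , _    | no  2+e≰k = contradiction (subst (Arc D (c e)) returns (step e)) (asym _ _ chord)
      where
      open Loop C
      returns : c (suc e) ≡ c 0
      returns = trans (cong c (≤-antisym e<k (≮⇒≥ 2+e≰k))) (LoopProperties.wrap C)

    analyse : (C : Loop k) → OddShortcut k ⊎ (Apart C × Induced C)
    analyse C = checkRepeats (anyUpTo? repeat? k)
      where
      open Loop C

      Repeat : ℕ → Set
      Repeat b = ∃[ a ] (a < b × c a ≡ c b)

      repeat? : ∀ b → Dec (Repeat b)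
      repeat? b = anyUpTo? (λ a → c a ≟ᶠ c b) b

      Skip : ℕ → Set
      Skip a = ∃[ b ] (b < k × Arc D (c a) (c b) × c b ≢ c (suc a))

      skip? : ∀ a → Dec (Skip a)
      skip? a = anyUpTo? (λ b → T? (arc D (c a) (c b)) ×? ¬? (c b ≟ᶠ c (suc a))) k

      -- offset 0 would be a loop and offset 1 the next vertex, so a
      -- skipping arc is a chord over at least two steps
      module _ (apart : Apart C) where
        skip⇒shortcut : ∀ {a} → a < k → Skip a → OddShortcut k
        skip⇒shortcut {a} a<k (b , b<k , arc , skips) with LoopProperties.offset C a<k b<k
        ... | zero , _ , cb≡ca+0 = contradiction (subst (Arc D (c a)) (trans cb≡ca+0 (cong c (+-identityʳ a))) arc) (loopless D (c a))
        ... | suc zero , _ , cb≡ca+1 = contradiction (trans cb≡ca+1 (cong c (+-comm a 1))) skips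
        ... | suc (suc e) , e<k , cb≡ca+e = chord⇒shortcut (rotate a C) (rotate-apart a C apart) (s≤s (s≤s z≤n)) e<k
          (subst₂ (Arc D) (cong c (sym (+-identityʳ a))) cb≡ca+e arc)

      checkRepeats : Dec (∃[ b ] (b < k × Repeat b)) → OddShortcut k ⊎ (Apart C × Induced C)
      checkRepeats (yes (b , b<k , a , a<b , ca≡cb)) = inj₁ (LoopProperties.Odd.repeat⇒shortcut C odd a<b b<k ca≡cb)
      checkRepeats (no no-repeat) = checkSkips (anyUpTo? skip? k)
        where
        apart : Apart C
        apart = LoopProperties.window⇒apart C k>0 (λ a b a<b b<k eq → no-repeat (b , b<k , a , a<b , eq))
        checkSkips : Dec (∃[ a ] (a < k × Skip a)) → OddShortcut k ⊎ (Apart C × Induced C)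
        checkSkips (yes (a , a<k , skip)) = inj₁ (skip⇒shortcut apart a<k skip)
        checkSkips (no no-skip) = inj₂ (apart , InducedProperties.window⇒induced C k>0 induced)
          where
          induced : ∀ a b → a < k → b < k → Arc D (c a) (c b) → c b ≡ c (suc a)
          induced a b a<k b<k arc = decidable-stable (c b ≟ᶠ c (suc a)) (λ skips → no-skip (a , a<k , b , b<k , arc , skips))

  InducedOddLoop : ℕ → Set
  InducedOddLoop j = parity j ≡ 1ℙ × Σ (Loop j) (λ C → Apart C × Induced C)

  -- Given handlers for all odd lengths up to k, an odd closed walk of length
  -- k yields an apart, induced odd loop of length at most k: take shortcuts
  -- as long as there are any (strong induction on the length).
  induced-odd-loop : ∀ k → HandlersUpTo k → parity k ≡ 1ℙ
                   → ∀ {x} → Walk x x k → ∃[ j ] (j ≤ k × InducedOddLoop j)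
  induced-odd-loop = <-rec P descend
    where
    P : ℕ → Set
    P k = HandlersUpTo k → parity k ≡ 1ℙ
        → ∀ {x} → Walk x x k → ∃[ j ] (j ≤ k × InducedOddLoop j)
    descend : ∀ k → (∀ {L} → L < k → P L) → P k
    descend k shorter handlers odd w with Analysis.analyse odd (handlers ≤-refl odd) (toLoop odd w)
    ... | inj₂ (apart , induced) = k , ≤-refl , odd , toLoop odd w , apart , induced
    ... | inj₁ (L , L<k , odd-L , _ , w′) with shorter L<k (λ j≤L → handlers (≤-trans j≤L (<⇒≤ L<k))) odd-L w′
    ...   | j , j≤L , found = j , ≤-trans j≤L (<⇒≤ L<k) , found

module KernelCritical (D : Digraph) (kernel-free : ¬ HasKernel D)
                      (proper-kernels : ∀ X → X ⊂ ⊤ → HasKernelIn D X) where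
  open Walks D

  Semikernel : Subset (n D) → Set
  Semikernel S = (∀ x y → x ∈ S → y ∈ S → ¬ Arc D x y)
               × (∀ x y → x ∈ S → Arc D x y → ∃[ t ] (t ∈ S × Arc D y t))

  -- A nonempty semikernel S extends to a kernel of D by a kernel of the
  -- subdigraph of vertices neither in S nor with an arc into S.
  no-semikernel : ∀ {S u} → u ∈ S → ¬ Semikernel S
  no-semikernel {S} {u} u∈S (independent , answered) = extend (proper-kernels Y (missing⇒⊂ u∉Y))
    where
    ToS : V → Set
    ToS z = ∃[ t ] (t ∈ S × Arc D z t)
    toS? : ∀ z → Dec (ToS z)
    toS? z = any? (λ t → t ∈? S ×? T? (arc D z t))
    Y : Subset (n D)
    Y = ∁ (S ∪ ⟪ toS? ⟫)
    outside : ∀ {z} → z ∈ Y → z ∉ S × ¬ ToS z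
    outside z∈Y = (λ z∈S → x∈∁p⇒x∉p z∈Y (p⊆p∪q _ z∈S)) , (λ to → x∈∁p⇒x∉p z∈Y (x∈p∪q⁺ (inj₂ (∈⟪⟫⁺ toS? to))))
    u∉Y : u ∉ Y
    u∉Y u∈Y = proj₁ (outside u∈Y) u∈S
    extend : HasKernelIn D Y → ⊥
    extend (K′ , K′⊆Y , independentY , absorbentY) = kernel-free (S ∪ K′ , ⊆⊤ , independent′ , absorbent′)
      where
      independent′ : ∀ x y → x ∈ S ∪ K′ → y ∈ S ∪ K′ → ¬ Arc D x y
      independent′ x y x∈ y∈ arc with x∈p∪q⁻ S K′ x∈ | x∈p∪q⁻ S K′ y∈
      ... | inj₁ x∈S | inj₁ y∈S = independent x y x∈S y∈S arc
      ... | inj₁ x∈S | inj₂ y∈K = proj₂ (outside (K′⊆Y y∈K)) (answered x y x∈S arc)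
      ... | inj₂ x∈K | inj₁ y∈S = proj₂ (outside (K′⊆Y x∈K)) (y , y∈S , arc)
      ... | inj₂ x∈K | inj₂ y∈K = independentY x y x∈K y∈K arc
      absorbent′ : ∀ z → z ∈ ⊤ → z ∉ S ∪ K′ → ∃[ t ] (t ∈ S ∪ K′ × Arc D z t)
      absorbent′ z _ z∉ with toS? z
      ... | yes (t , t∈S , arc) = t , x∈p∪q⁺ (inj₁ t∈S) , arc
      ... | no ¬to with absorbentY z z∈Y (λ z∈K → z∉ (x∈p∪q⁺ (inj₂ z∈K)))
        where
        z∈Y : z ∈ Y
        z∈Y = x∉p⇒x∈∁p λ z∈ → [ (λ z∈S → z∉ (x∈p∪q⁺ (inj₁ z∈S))) , (λ z∈T → ¬to (∈⟪⟫⁻ toS? z∈T)) ] (x∈p∪q⁻ S _ z∈)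
      ...   | t , t∈K , arc = t , x∈p∪q⁺ (inj₂ t∈K) , arc

  -- there are no sinks: a sink alone would be a semikernel
  out-neighbour : ∀ v → ∃[ y ] Arc D v y
  out-neighbour v with any? (λ y → T? (arc D v y))
  ... | yes found = found
  ... | no  sink  = contradiction (independent , λ x y x∈ arc → contradiction (y , subst (λ w → Arc D w y) (x∈⁅y⁆⇒x≡y v x∈) arc) sink)
                                  (no-semikernel (x∈⁅x⁆ v))
    where
    independent : ∀ x y → x ∈ ⁅ v ⁆ → y ∈ ⁅ v ⁆ → ¬ Arc D x y
    independent x y x∈ y∈ arc = loopless D v (subst₂ (Arc D) (x∈⁅y⁆⇒x≡y v x∈) (x∈⁅y⁆⇒x≡y v y∈) arc)

  Closed : Subset (n D) → Set
  Closed X = ∀ y z → y ∈ X → Arc D y z → z ∈ X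

  HasArcFrom : Subset (n D) → V → Set
  HasArcFrom X z = ∃[ y ] (y ∈ X × Arc D y z)

  hasArcFrom? : ∀ X z → Dec (HasArcFrom X z)
  hasArcFrom? X z = any? (λ y → y ∈? X ×? T? (arc D y z))

  reach : V → ℕ → Subset (n D)
  reach a zero    = ⁅ a ⁆
  reach a (suc t) = reach a t ∪ ⟪ hasArcFrom? (reach a t) ⟫

  reach-walk : ∀ a t {z} → z ∈ reach a t → ∃[ ℓ ] Walk a z ℓ
  reach-walk a zero z∈ with refl ← x∈⁅y⁆⇒x≡y a z∈ = 0 , []
  reach-walk a (suc t) z∈ with x∈p∪q⁻ (reach a t) _ z∈
  ... | inj₁ z∈′ = reach-walk a t z∈′
  ... | inj₂ z∈′ with ∈⟪⟫⁻ (hasArcFrom? (reach a t)) z∈′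
  ...   | y , y∈ , arc with reach-walk a t y∈
  ...     | ℓ , w = ℓ + 1 , w ++ (arc ∷ [])

  reach-start : ∀ a t → a ∈ reach a t
  reach-start a zero    = x∈⁅x⁆ a
  reach-start a (suc t) = p⊆p∪q _ (reach-start a t)

  growth : ∀ a t → suc t ≤ ∣ reach a t ∣ ⊎ ∃[ s ] Closed (reach a s)
  growth a zero = inj₁ (≤-reflexive (sym (∣⁅x⁆∣≡1 a)))
  growth a (suc t) with growth a t
  ... | inj₂ closed = inj₂ closed
  ... | inj₁ large with any? (λ z → z ∈? reach a (suc t) ×? ¬? (z ∈? reach a t))
  ...   | yes (z , z∈new , z∉old) = inj₁ (<-≤-trans (s≤s large) (p⊂q⇒∣p∣<∣q∣ (p⊆p∪q _ , z , z∈new , z∉old)))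
  ...   | no no-new = inj₂ (t , λ y z y∈ arc →
            decidable-stable (z ∈? reach a t) (λ z∉ → no-new (z , x∈p∪q⁺ (inj₂ (∈⟪⟫⁺ (hasArcFrom? (reach a t)) (y , y∈ , arc))) , z∉)))

  closed-reach : ∀ a → ∃[ s ] Closed (reach a s)
  closed-reach a with growth a (n D)
  ... | inj₂ closed = closed
  ... | inj₁ large  = contradiction (<-≤-trans large (∣p∣≤n (reach a (n D)))) (<-irrefl refl)

  -- D is strongly connected: a kernel of a proper closed subdigraph would
  -- be a semikernel of D
  strongly-connected : ∀ a z → ∃[ ℓ ] Walk a z ℓ
  strongly-connected a z with closed-reach a
  ... | s , closed with z ∈? reach a s
  ...   | yes z∈ = reach-walk a s z∈
  ...   | no  z∉ with proper-kernels (reach a s) (missing⇒⊂ z∉)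
  ...     | K , K⊆X , independent , absorbent = contradiction (independent , answered) (no-semikernel (proj₂ member))
    where
    member : ∃[ u ] (u ∈ K)
    member with a ∈? K
    ... | yes a∈K = a , a∈K
    ... | no  a∉K with absorbent a (reach-start a s) a∉K
    ...   | t , t∈K , _ = t , t∈K
    answered : ∀ x y → x ∈ K → Arc D x y → ∃[ t ] (t ∈ K × Arc D y t)
    answered x y x∈K arc = absorbent y (closed x y (K⊆X x∈K) arc) (λ y∈K → independent x y x∈K y∈K arc)

  -- D has a vertex: otherwise the empty vertex set would be a kernel
  some-vertex : V
  some-vertex with any? (λ (_ : V) → yes tt)
  ... | yes (v , _) = v
  ... | no  none    = contradiction (⊤ , (λ {_} x∈ → x∈) , (λ u _ _ _ _ → none (u , tt)) , λ u _ _ → contradiction (u , tt) none)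
                                    kernel-free

  u : V
  u = some-vertex

  dist : V → ℕ
  dist z = proj₁ (strongly-connected u z)

  path : ∀ z → Walk u z (dist z)
  path z = proj₂ (strongly-connected u z)

  -- D has an odd closed walk: otherwise the vertices at even distance from
  -- a fixed vertex would form a kernel
  odd-closed-walk : ∃[ L ] (parity L ≡ 1ℙ × ∃[ x ] Walk x x L)
  odd-closed-walk with any? (λ z → any? (λ y → T? (arc D z y) ×? (parity (dist z) ≟ᴾ parity (dist y))))
  ... | yes (z , y , arc , same) = close (strongly-connected y u)
    where
    close : ∃[ m ] Walk y u m → ∃[ L ] (parity L ≡ 1ℙ × ∃[ x ] Walk x x L)
    close (m , back) with parity (dist y + m) in parity-y
    ... | 1ℙ = dist y + m , parity-y , u , path y ++ back
    ... | 0ℙ = dist z + suc m , odd′ , u , path z ++ (arc ∷ back)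
      where
      odd′ : parity (dist z + suc m) ≡ 1ℙ
      odd′ = begin
        parity (dist z + suc m)               ≡⟨ parity-+suc (dist z) m ⟩
        parity (dist z + m) ⁻¹                ≡⟨ cong _⁻¹ (ℙ.+-homo-+ (dist z) m) ⟩
        (parity (dist z) +ᴾ parity m) ⁻¹      ≡⟨ cong (λ p → (p +ᴾ parity m) ⁻¹) same ⟩
        (parity (dist y) +ᴾ parity m) ⁻¹      ≡⟨ cong _⁻¹ (sym (ℙ.+-homo-+ (dist y) m)) ⟩
        parity (dist y + m) ⁻¹                ≡⟨ cong _⁻¹ parity-y ⟩
        1ℙ                                    ∎
        where open ≡-Reasoning
  ... | no  alternating = ⊥-elim (kernel-free (⟪ even? ⟫ , ⊆⊤ , independent , absorbent))
    where
    even? : ∀ z → Dec (parity (dist z) ≡ 0ℙ)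
    even? z = parity (dist z) ≟ᴾ 0ℙ
    independent : ∀ x y → x ∈ ⟪ even? ⟫ → y ∈ ⟪ even? ⟫ → ¬ Arc D x y
    independent x y x∈ y∈ arc = alternating (x , y , arc , trans (∈⟪⟫⁻ even? x∈) (sym (∈⟪⟫⁻ even? y∈)))
    absorbent : ∀ z → z ∈ ⊤ → z ∉ ⟪ even? ⟫ → ∃[ y ] (y ∈ ⟪ even? ⟫ × Arc D z y)
    absorbent z _ z∉ with out-neighbour z
    ... | y , arc = y , ∈⟪⟫⁺ even? (decidable-stable (even? y) λ y-odd →
                          alternating (z , y , arc , both-odd (λ e → z∉ (∈⟪⟫⁺ even? e)) y-odd)) , arc

  open InducedLoops D

  -- An induced odd loop passes through every vertex: otherwise the vertices
  -- on it would induce a proper subdigraph without a kernel.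
  loop-spans : ∀ {k} → parity k ≡ 1ℙ → (C : Loop k) → Induced C → Spanning C
  loop-spans {k} odd C induced z = decidable-stable (onLoop? z) off-loop-impossible
    where
    open Loop C
    OnLoop : V → Set
    OnLoop y = ∃[ a ] (a < k × c a ≡ y)
    onLoop? : ∀ y → Dec (OnLoop y)
    onLoop? y = anyUpTo? (λ a → c a ≟ᶠ y) k
    onX : ∀ a → c a ∈ ⟪ onLoop? ⟫
    onX a with LoopProperties.reduce C (odd⇒pos odd) a
    ... | r , r<k , shift = ∈⟪⟫⁺ onLoop? (r , r<k , sym (shift 0))
    fromX : ∀ y → y ∈ ⟪ onLoop? ⟫ → ∃[ b ] c b ≡ y
    fromX y y∈ with ∈⟪⟫⁻ onLoop? y∈
    ... | b , _ , cb≡y = b , cb≡y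
    off-loop-impossible : ¬ ¬ OnLoop z
    off-loop-impossible z-off with proper-kernels ⟪ onLoop? ⟫ (missing⇒⊂ (λ z∈ → z-off (∈⟪⟫⁻ onLoop? z∈)))
    ... | K , kernel = InducedProperties.no-kernel C odd induced onX fromX kernel

  induced-loop⇒cycle : ∀ {k} → parity k ≡ 1ℙ → (C : Loop k) → Apart C → Induced C → IsDirectedCycle D × n D ≡ k
  induced-loop⇒cycle odd C apart induced =
    isDirectedCycle (odd-length≥3 odd C) , sym k≡n
    where open SpanningLoop C apart induced (loop-spans odd C induced)

  -- In a 3-quasi-transitive digraph, any vertex v lies on a directed
  -- triangle s → v → a → s, where S is a kernel of D - v, s ∈ S, and a is
  -- an out-neighbour of v.
  triangle-3qt : ThreeQuasiTransitive D → ∃[ x ] Walk x x 3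
  triangle-3qt tqt = around (proper-kernels X (missing⇒⊂ v∉X))
    where
    v : V
    v = some-vertex
    X : Subset (n D)
    X = ∁ ⁅ v ⁆
    v∉X : v ∉ X
    v∉X v∈X = x∈∁p⇒x∉p v∈X (x∈⁅x⁆ v)
    others∈X : ∀ {z} → z ≢ v → z ∈ X
    others∈X z≢v = x∉p⇒x∈∁p (λ z∈ → z≢v (x∈⁅y⁆⇒x≡y v z∈))
    around : HasKernelIn D X → ∃[ x ] Walk x x 3
    around (S , S⊆X , independentS , absorbentS) = triangle-at into-v (out-neighbour v)
      where
      -- v has no out-neighbour in S, or S would be a kernel of D
      no-arc-into-S : ∀ t → t ∈ S → ¬ Arc D v t
      no-arc-into-S t t∈S v→t = kernel-free (S , ⊆⊤ , independentS , absorbent)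
        where
        absorbent : ∀ z → z ∈ ⊤ → z ∉ S → ∃[ y ] (y ∈ S × Arc D z y)
        absorbent z _ z∉S with z ≟ᶠ v
        ... | yes refl = t , t∈S , v→t
        ... | no  z≢v  = absorbentS z (others∈X z≢v) z∉S
      -- some s ∈ S has an arc to v, or S ∪ {v} would be a kernel of D
      into-v : ∃[ s ] (s ∈ S × Arc D s v)
      into-v with any? (λ s → s ∈? S ×? T? (arc D s v))
      ... | yes found = found
      ... | no  none  = ⊥-elim (kernel-free (S ∪ ⁅ v ⁆ , ⊆⊤ , independent , absorbent))
        where
        independent : ∀ x y → x ∈ S ∪ ⁅ v ⁆ → y ∈ S ∪ ⁅ v ⁆ → ¬ Arc D x y
        independent x y x∈ y∈ arc with x∈p∪q⁻ S _ x∈ | x∈p∪q⁻ S _ y∈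
        ... | inj₁ x∈S | inj₁ y∈S = independentS x y x∈S y∈S arc
        ... | inj₁ x∈S | inj₂ y∈v = none (x , x∈S , subst (Arc D x) (x∈⁅y⁆⇒x≡y v y∈v) arc)
        ... | inj₂ x∈v | inj₁ y∈S = no-arc-into-S y y∈S (subst (λ w → Arc D w y) (x∈⁅y⁆⇒x≡y v x∈v) arc)
        ... | inj₂ x∈v | inj₂ y∈v = loopless D v (subst₂ (Arc D) (x∈⁅y⁆⇒x≡y v x∈v) (x∈⁅y⁆⇒x≡y v y∈v) arc)
        absorbent : ∀ z → z ∈ ⊤ → z ∉ S ∪ ⁅ v ⁆ → ∃[ y ] (y ∈ S ∪ ⁅ v ⁆ × Arc D z y)
        absorbent z _ z∉ with absorbentS z (others∈X λ { refl → z∉ (x∈p∪q⁺ (inj₂ (x∈⁅x⁆ v))) })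
                                        (λ z∈S → z∉ (x∈p∪q⁺ (inj₁ z∈S)))
        ... | y , y∈S , arc = y , x∈p∪q⁺ (inj₁ y∈S) , arc
      -- an out-neighbour a of v is absorbed by some t ∈ S; if t ≠ s, then
      -- s → v → a → t would make s and t adjacent by 3-quasi-transitivity
      -- contradicting the independence of S
      triangle-at : ∃[ s ] (s ∈ S × Arc D s v) → ∃[ a ] Arc D v a → ∃[ x ] Walk x x 3
      triangle-at (s , s∈S , s→v) (a , v→a) = s , triangle s→v v→a a→s
        where
        a∉S : a ∉ S
        a∉S a∈S = no-arc-into-S a a∈S v→a
        a≢v : a ≢ v
        a≢v refl = loopless D v v→a
        a→s : Arc D a s
        a→s with absorbentS a (others∈X a≢v) a∉S
        ... | t , t∈S , a→t with t ≟ᶠ s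
        ...   | yes refl = a→t
        ...   | no  t≢s  with tqt s v a t distinct s→v v→a a→t
          where
          distinct : Distinct4 s v a t
          distinct = (λ { refl → v∉X (S⊆X s∈S) }) , (λ { refl → a∉S s∈S }) , (λ { refl → t≢s refl }) ,
                     (λ { refl → a≢v refl }) , (λ { refl → v∉X (S⊆X t∈S) }) , (λ { refl → a∉S t∈S })
        ...     | inj₁ s→t = ⊥-elim (independentS s t s∈S t∈S s→t)
        ...     | inj₂ t→s = ⊥-elim (independentS t s t∈S s∈S t→s)

  module Forward (asym : Asymmetric D) where
    open EvenChords D
    open OddLoops D asym

    cycle-within : ∀ {L x} → HandlersUpTo L → parity L ≡ 1ℙ → Walk x x L
                 → IsDirectedCycle D × parity (n D) ≡ 1ℙ × n D ≤ L
    cycle-within {L} handlers odd w with induced-odd-loop L handlers odd w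
    ... | j , j≤L , odd-j , C , apart , induced with induced-loop⇒cycle odd-j C apart induced
    ...   | cycle , n≡j = cycle , subst (λ m → parity m ≡ 1ℙ) (sym n≡j) odd-j , subst (_≤ L) (sym n≡j) j≤L

    odd-cycle : (∀ {j} → parity j ≡ 1ℙ → EvenChordHandler j) → IsDirectedCycle D × Odd (n D)
    odd-cycle handler =
      let (L , odd , _ , w) = odd-closed-walk
          (cycle , odd-n , _) = cycle-within (λ {j} _ → handler {j}) odd w
      in cycle , parity⇒Odd (n D) odd-n

    short-handler : HandlersUpTo 3
    short-handler j≤3 _ _ _ m _ 4+2m≤j = ⊥-elim (≤⇒≯ (≤-trans (m≤m+n 4 (twice m)) (≤-trans 4+2m≤j j≤3)) (n<1+n 3))

    triangle-cycle : ThreeQuasiTransitive D → IsDirectedCycle D × n D ≡ 3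
    triangle-cycle tqt =
      let (cycle , _ , n≤3) = cycle-within short-handler refl (proj₂ (triangle-3qt tqt))
      in cycle , ≤-antisym n≤3 (proj₁ cycle)

module OddDirectedCycle (D : Digraph) (cycle : IsDirectedCycle D) (odd-n : Odd (n D)) where
  open Walks D
  open InducedLoops D

  N : ℕ
  N = n D

  odd : parity N ≡ 1ℙ
  odd = Odd⇒parity N odd-n

  N>0 : 0 < N
  N>0 = odd⇒pos odd

  σ̂ : V ⤖ V
  σ̂ = proj₁ (proj₂ cycle)

  σ : V → V
  σ = Bijection.to σ̂

  arc⇔ : ∀ u v → Arc D u v ⇔ CycSucc (σ u) (σ v)
  arc⇔ = proj₂ (proj₂ cycle)

  label : V → ℕ
  label v = toℕ (σ v)

  label-injective : ∀ {u v} → label u ≡ label v → u ≡ v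
  label-injective eq = Bijection.injective σ̂ (toℕ-injective eq)

  vertexAt : ℕ → V
  vertexAt t with t <? N
  ... | yes t<N = proj₁ (Bijection.surjective σ̂ (fromℕ< t<N))
  ... | no  _   = proj₁ (Bijection.surjective σ̂ (fromℕ< N>0))

  label-vertexAt : ∀ {t} → t < N → label (vertexAt t) ≡ t
  label-vertexAt {t} t<N with t <? N
  ... | yes t<N′ = trans (cong toℕ (proj₂ (Bijection.surjective σ̂ (fromℕ< t<N′)) refl)) (toℕ-fromℕ< t<N′)
  ... | no  t≮N  = contradiction t<N t≮N

  label-vertexAt-N : label (vertexAt N) ≡ 0
  label-vertexAt-N with N <? N
  ... | yes N<N = contradiction N<N (<-irrefl refl)
  ... | no  _   = trans (cong toℕ (proj₂ (Bijection.surjective σ̂ (fromℕ< N>0)) refl)) (toℕ-fromℕ< N>0)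

  steps : ∀ t → t < N → Arc D (vertexAt t) (vertexAt (suc t))
  steps t t<N = Equivalence.from (arc⇔ _ _) successor
    where
    successor : CycSucc (σ (vertexAt t)) (σ (vertexAt (suc t)))
    successor = by-cases (suc t <? N)
      where
      by-cases : Dec (suc t < N) → CycSucc (σ (vertexAt t)) (σ (vertexAt (suc t)))
      by-cases (yes st<N) = inj₁ (trans (cong suc (label-vertexAt t<N)) (sym (label-vertexAt st<N)))
      by-cases (no  st≮N) = inj₂ (trans (cong suc (label-vertexAt t<N)) st≡N ,
                                  trans (cong (λ m → label (vertexAt m)) st≡N) label-vertexAt-N)
        where
        st≡N : suc t ≡ N
        st≡N = ≤-antisym t<N (≮⇒≥ st≮N)

  round : Walk (vertexAt 0) (vertexAt 0) N
  round = subst (λ y → Walk (vertexAt 0) y N)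
                (label-injective (trans label-vertexAt-N (sym (label-vertexAt N>0))))
                (trace vertexAt N steps)

  C : Loop N
  C = toLoop odd round

  open Loop C
  open LoopProperties C

  position : ∀ t → t < N → label (c t) ≡ t
  position zero    0<N  = trans (cong label (toLoop-start odd round)) (label-vertexAt 0<N)
  position (suc t) st<N with Equivalence.to (arc⇔ _ _) (step t)
  ... | inj₁ e       = trans (sym e) (cong suc (position t (<-trans (n<1+n t) st<N)))
  ... | inj₂ (e , _) = contradiction (trans (cong suc (sym (position t (<-trans (n<1+n t) st<N)))) e) (<⇒≢ st<N)

  apart : Apart C
  apart = window⇒apart N>0 λ a b a<b b<N ca≡cb →
    <⇒≢ a<b (trans (sym (position a (<-trans a<b b<N))) (trans (cong label ca≡cb) (position b b<N)))

  induced : Induced C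
  induced = InducedProperties.window⇒induced C N>0 next
    where
    next : ∀ a b → a < N → b < N → Arc D (c a) (c b) → c b ≡ c (suc a)
    next a b a<N b<N arc with Equivalence.to (arc⇔ _ _) arc
    ... | inj₁ e        = cong c (trans (sym (position b b<N)) (trans (sym e) (cong suc (position a a<N))))
    ... | inj₂ (e , e₀) = trans (cong c (trans (sym (position b b<N)) e₀))
                                (trans (sym wrap) (cong c (trans (sym e) (cong suc (position a a<N)))))

  spanning : Spanning C
  spanning z = label z , toℕ<n (σ z) , label-injective (position (label z) (toℕ<n (σ z)))

  critical : CKI D
  critical = odd-spanning-loop⇒CKI odd C apart induced spanning

theorem11 :
    (∀ (D : Digraph) → Asymmetric D → ThreeQuasiTransitive D →
      (CKI D ⇔ (IsDirectedCycle D × n D ≡ 3)))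
    × (∀ (D : Digraph) → Asymmetric D →
      (ArcLocallyInSemicomplete D ⊎ ArcLocallyOutSemicomplete D
        ⊎ (ThreeAntiQuasiTransitive D × TT3Free D)) →
      (CKI D ⇔ (IsDirectedCycle D × Odd (n D))))
theorem11 = three-quasi-transitive , local-classes
  where
  three-quasi-transitive : ∀ D → Asymmetric D → ThreeQuasiTransitive D → CKI D ⇔ (IsDirectedCycle D × n D ≡ 3)
  three-quasi-transitive D asym tqt = mk⇔
    (λ (kernel-free , proper) → KernelCritical.Forward.triangle-cycle D kernel-free proper asym tqt)
    (λ (cycle , n≡3) → OddDirectedCycle.critical D cycle (subst Odd (sym n≡3) (1 , refl)))

  local-classes : ∀ D → Asymmetric D
    → ArcLocallyInSemicomplete D ⊎ ArcLocallyOutSemicomplete D ⊎ (ThreeAntiQuasiTransitive D × TT3Free D)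
    → CKI D ⇔ (IsDirectedCycle D × Odd (n D))
  local-classes D asym class = mk⇔
    (λ (kernel-free , proper) →
       KernelCritical.Forward.odd-cycle D kernel-free proper asym (EvenChords.class-handler D asym class))
    (λ (cycle , odd) → OddDirectedCycle.critical D cycle odd)
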